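{- Let $a\ge 3$ and $m$ be integers with $\frac{2a}{3}+1\leq m\leq a$, and let $R_2(m,a)$ denote the 2-color Rado number of $x_1+\cdots+x_{m-1}=ax_m$. Then for $a=3$ we have $R_2(a,a)=9$, and for $a\geq 4$ we have $R_2(m,a)=3$ if $a\equiv m-1\pmod 2$ and $R_2(m,a)=4$ if $a\not\equiv m-1\pmod 2$.
   Context: The 2-color Rado number $R_2(m,a)$ of $x_1+\cdots+x_{m-1}=ax_m$ is the least positive integer $n$ such that for every coloring of $[n]=\{1,\dots,n\}$ with two colors there exist $x_1,\dots,x_m\in[n]$ (not necessarily distinct), all of the same color, satisfying the equation. -}

module Defs where

open import Data.Nat using (ℕ; zero; suc; _+_; _*_; _∸_; _≤_; _<_)
open import Data.Bool using (Bool)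
open import Data.Vec using (Vec)
open import Data.Vec.Relation.Unary.All using (All)
open import Data.Product using (Σ; _×_; ∃)
open import Relation.Binary.PropositionalEquality using (_≡_)
open import Relation.Nullary using (¬_)

-- A 2-coloring; only its values on [n] = {1,…,n} are relevant.
Coloring : Set
Coloring = ℕ → Bool

InRange : ℕ → ℕ → Set
InRange n x = 1 ≤ x × x ≤ n

vsum : ∀ {k} → Vec ℕ k → ℕ
vsum Vec.[] = 0
vsum (x Vec.∷ xs) = x + vsum xs

-- A monochromatic solution in [n] of x₁ + ⋯ + x_{m-1} = a·x_m under coloring c:
-- xs = (x₁,…,x_{m-1}), xm = x_m, all in [n], all of colour col (not necessarily distinct).
MonoSol : (m a n : ℕ) → Coloring → Set
MonoSol m a n c =
  Σ Bool λ col → Σ (Vec ℕ (m ∸ 1)) λ xs → Σ ℕ λ xm →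
    All (λ x → InRange n x × c x ≡ col) xs ×
    InRange n xm × c xm ≡ col ×
    vsum xs ≡ a * xm

Arrows : (m a n : ℕ) → Set
Arrows m a n = (c : Coloring) → MonoSol m a n c

Rado2Is : (m a r : ℕ) → Set
Rado2Is m a r = 1 ≤ r × Arrows m a r × (∀ n → 1 ≤ n → n < r → ¬ Arrows m a n)

-- Write m = K + 1 with K = 2s + q and a = 3s + q, so s = a − K ≥ 1 and q = 3K − 2a ≥ 0.
-- If two of 1, 2, 3 share a colour there is a monochromatic solution: s 2's and s + q 1's
-- (sum a·1), 2s 3's and q 2's (sum a·2), or, for even s, s/2 3's and 3s/2 + q 1's (sum a·1).
-- For odd s the pair {2, 4} also works (s 4's and s + q 2's), and if 2 is alone in its colour
-- then 1, 3, 4 share the other one, which carries a solution unless s = 1 and q = 0, i.e. a = m = 3.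
-- The lower bounds come from colouring by parity: a colour class {v} forces K·v = a·v, impossible
-- as K < a, and a class of odd numbers forces K ≡ a (mod 2), impossible for odd s.
-- For a = m = 3 the bound 9 is a short case analysis, and the colouring of [8] by {1, 3, 4, 7},
-- {2, 5, 6, 8} has no monochromatic solution, which is checked by computation.

module Submission where

open import Defs
open import Data.Bool using (Bool; true; false; T)
import Data.Bool.Properties as Bool
open import Data.Nat using (ℕ; zero; suc; _+_; _*_; _≤_; _<_; _%_; _≡ᵇ_; _≤?_; z≤n; s≤s; NonZero)
open import Data.Nat.Properties
open import Data.Nat.DivMod using (%-distribˡ-+; %-distribˡ-*; m%n%n≡m%n; [m+n]%n≡m%n; [m+kn]%n≡m%n; m*n%n≡0)
open import Data.Nat.Tactic.RingSolver using (solve-∀)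
open import Data.Product using (_×_; _,_; ∃₂; proj₁; proj₂)
open import Data.Unit using (tt)
open import Function using (_∘_)
open import Data.Vec using (Vec; []; _∷_; _++_; replicate)
open import Data.Vec.Relation.Unary.All as All using (All; []; _∷_)
open import Data.Vec.Relation.Unary.All.Properties using (++⁺)
open import Relation.Binary.PropositionalEquality
open import Relation.Nullary using (¬_; yes; no; contradiction)
open import Relation.Nullary.Decidable using (Dec; True; toWitness; from-yes; _→-dec_; ¬?)

vsum-++ : ∀ {k l} (xs : Vec ℕ k) (ys : Vec ℕ l) → vsum (xs ++ ys) ≡ vsum xs + vsum ys
vsum-++ []       ys = refl
vsum-++ (x ∷ xs) ys = trans (cong (x +_) (vsum-++ xs ys)) (sym (+-assoc x _ _))

vsum-replicate : ∀ k x → vsum (replicate k x) ≡ k * x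
vsum-replicate zero    x = refl
vsum-replicate (suc k) x = cong (x +_) (vsum-replicate k x)

vsum-const : ∀ {k v} {xs : Vec ℕ k} → All (_≡ v) xs → vsum xs ≡ k * v
vsum-const []            = refl
vsum-const (refl ∷ xs≡v) = cong (_ +_) (vsum-const xs≡v)

All-replicate⁺ : ∀ {P : ℕ → Set} k {x} → P x → All P (replicate k x)
All-replicate⁺ zero    px = []
All-replicate⁺ (suc k) px = px ∷ All-replicate⁺ k px

Coloured : ℕ → Coloring → Bool → ℕ → Set
Coloured n c col x = InRange n x × c x ≡ col

in-range : ∀ {k n} x {_ : True (1 ≤? x)} {_ : True (x ≤? k)} → k ≤ n → InRange n x
in-range x {p} {q} k≤n = toWitness p , ≤-trans (toWitness q) k≤n

InRange-mono : ∀ {n n′ x} → n ≤ n′ → InRange n x → InRange n′ x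
InRange-mono n≤n′ (1≤x , x≤n) = 1≤x , ≤-trans x≤n n≤n′

Coloured-mono : ∀ {n n′ c col x} → n ≤ n′ → Coloured n c col x → Coloured n′ c col x
Coloured-mono n≤n′ (x∈ , c-x) = InRange-mono n≤n′ x∈ , c-x

MonoSol-mono : ∀ {m a n n′ c} → n ≤ n′ → MonoSol m a n c → MonoSol m a n′ c
MonoSol-mono {c = c} n≤n′ (col , xs , xm , xs-col , xm∈ , c-xm , eq) =
  col , xs , xm , All.map (Coloured-mono {c = c} n≤n′) xs-col , InRange-mono n≤n′ xm∈ , c-xm , eq

Arrows-mono : ∀ {m a n n′} → n ≤ n′ → Arrows m a n → Arrows m a n′
Arrows-mono {m} {a} n≤n′ arrows c = MonoSol-mono {m} {a} n≤n′ (arrows c)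

rado-from-threshold : ∀ {K a r} → Arrows (suc K) a (suc r) → ¬ Arrows (suc K) a r →
  Rado2Is (suc K) a (suc r)
rado-from-threshold {K} {a} arrows ¬arrows =
  s≤s z≤n , arrows , λ n _ n<1+r arrows-n → ¬arrows (Arrows-mono {suc K} {a} (≤-pred n<1+r) arrows-n)

two-colours : ∀ {x y z : Bool} → x ≢ z → y ≢ z → x ≡ y
two-colours x≢z y≢z = trans (Bool.¬-not x≢z) (sym (Bool.¬-not y≢z))

module _ {n : ℕ} {c : Coloring} where

  three-value-solution : ∀ {K a} i u j v k w xm → i + j + k ≡ K → i * u + j * v + k * w ≡ a * xm →
    InRange n u → InRange n v → InRange n w → InRange n xm →
    c u ≡ c xm → c v ≡ c xm → c w ≡ c xm → MonoSol (suc K) a n c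
  three-value-solution i u j v k w xm refl sum u∈ v∈ w∈ xm∈ cu cv cw =
    c xm , (replicate i u ++ replicate j v) ++ replicate k w , xm ,
    ++⁺ (++⁺ (All-replicate⁺ i (u∈ , cu)) (All-replicate⁺ j (v∈ , cv))) (All-replicate⁺ k (w∈ , cw)) ,
    xm∈ , refl , trans blocks-sum sum
    where
    open ≡-Reasoning
    blocks-sum : vsum ((replicate i u ++ replicate j v) ++ replicate k w) ≡ i * u + j * v + k * w
    blocks-sum = begin
      vsum ((replicate i u ++ replicate j v) ++ replicate k w)
        ≡⟨ vsum-++ (replicate i u ++ replicate j v) (replicate k w) ⟩
      vsum (replicate i u ++ replicate j v) + vsum (replicate k w)
        ≡⟨ cong₂ _+_ (vsum-++ (replicate i u) (replicate j v)) (vsum-replicate k w) ⟩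
      vsum (replicate i u) + vsum (replicate j v) + k * w
        ≡⟨ cong₂ (λ p q → p + q + k * w) (vsum-replicate i u) (vsum-replicate j v) ⟩
      i * u + j * v + k * w ∎

  two-value-solution : ∀ {K a} i u j v xm → i + j ≡ K → i * u + j * v ≡ a * xm →
    InRange n u → InRange n v → InRange n xm → c u ≡ c xm → c v ≡ c xm → MonoSol (suc K) a n c
  two-value-solution {K} {a} i u j v xm count sum u∈ v∈ xm∈ cu cv =
    three-value-solution {K} {a} i u j v 0 u xm
      (trans (+-identityʳ (i + j)) count) (trans (+-identityʳ _) sum) u∈ v∈ u∈ xm∈ cu cv cu

  solution-1-2 : ∀ s q → 2 ≤ n → c 2 ≡ c 1 → MonoSol (suc (2 * s + q)) (3 * s + q) n c
  solution-1-2 s q 2≤n c₂ = two-value-solution {a = 3 * s + q} s 2 (s + q) 1 1 (count s q) (sum s q)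
    (in-range 2 2≤n) (in-range 1 2≤n) (in-range 1 2≤n) c₂ refl
    where
    count : ∀ s q → s + (s + q) ≡ 2 * s + q
    count = solve-∀
    sum : ∀ s q → s * 2 + (s + q) * 1 ≡ (3 * s + q) * 1
    sum = solve-∀

  solution-2-3 : ∀ s q → 3 ≤ n → c 3 ≡ c 2 → MonoSol (suc (2 * s + q)) (3 * s + q) n c
  solution-2-3 s q 3≤n c₃ = two-value-solution {a = 3 * s + q} (2 * s) 3 q 2 2 refl (sum s q)
    (in-range 3 3≤n) (in-range 2 3≤n) (in-range 2 3≤n) c₃ refl
    where
    sum : ∀ s q → 2 * s * 3 + q * 2 ≡ (3 * s + q) * 2
    sum = solve-∀

  solution-2-4 : ∀ s q → 4 ≤ n → c 4 ≡ c 2 → MonoSol (suc (2 * s + q)) (3 * s + q) n c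
  solution-2-4 s q 4≤n c₄ = two-value-solution {a = 3 * s + q} s 4 (s + q) 2 2 (count s q) (sum s q)
    (in-range 4 4≤n) (in-range 2 4≤n) (in-range 2 4≤n) c₄ refl
    where
    count : ∀ s q → s + (s + q) ≡ 2 * s + q
    count = solve-∀
    sum : ∀ s q → s * 4 + (s + q) * 2 ≡ (3 * s + q) * 2
    sum = solve-∀

  solution-1-3 : ∀ t q → 3 ≤ n → c 3 ≡ c 1 → MonoSol (suc (2 * (t * 2) + q)) (3 * (t * 2) + q) n c
  solution-1-3 t q 3≤n c₃ = two-value-solution {a = 3 * (t * 2) + q} t 3 (3 * t + q) 1 1 (count t q) (sum t q)
    (in-range 3 3≤n) (in-range 1 3≤n) (in-range 1 3≤n) c₃ refl
    where
    count : ∀ t q → t + (3 * t + q) ≡ 2 * (t * 2) + q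
    count = solve-∀
    sum : ∀ t q → t * 3 + (3 * t + q) * 1 ≡ (3 * (t * 2) + q) * 1
    sum = solve-∀

  solution-1-3-4 : ∀ t q → 4 ≤ 3 * (1 + t * 2) + q → 4 ≤ n → c 3 ≡ c 1 → c 4 ≡ c 1 →
    MonoSol (suc (2 * (1 + t * 2) + q)) (3 * (1 + t * 2) + q) n c
  solution-1-3-4 zero zero (s≤s (s≤s (s≤s ())))
  solution-1-3-4 zero (suc q) _ 4≤n c₃ c₄ = two-value-solution {a = 4 + q} 3 4 q 3 3 (count q) (sum q)
    (in-range 4 4≤n) (in-range 3 4≤n) (in-range 3 4≤n) (trans c₄ (sym c₃)) refl
    where
    count : ∀ q → 3 + q ≡ 2 + suc q
    count = solve-∀
    sum : ∀ q → 3 * 4 + q * 3 ≡ (4 + q) * 3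
    sum = solve-∀
  solution-1-3-4 (suc h) q _ 4≤n c₃ c₄ =
    three-value-solution {a = 3 * (1 + suc h * 2) + q} 1 4 h 3 (3 * h + 5 + q) 1 1 (count h q) (sum h q)
      (in-range 4 4≤n) (in-range 3 4≤n) (in-range 1 4≤n) (in-range 1 4≤n) c₄ c₃ refl
    where
    count : ∀ h q → 1 + h + (3 * h + 5 + q) ≡ 2 * (1 + suc h * 2) + q
    count = solve-∀
    sum : ∀ h q → 1 * 4 + h * 3 + (3 * h + 5 + q) * 1 ≡ (3 * (1 + suc h * 2) + q) * 1
    sum = solve-∀

arrows-3 : ∀ t q → Arrows (suc (2 * (t * 2) + q)) (3 * (t * 2) + q) 3
arrows-3 t q c with c 2 Bool.≟ c 1 | c 3 Bool.≟ c 2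
... | yes c₂ | _      = solution-1-2 (t * 2) q (n≤1+n 2) c₂
... | no _   | yes c₃ = solution-2-3 (t * 2) q ≤-refl c₃
... | no c₂  | no c₃  = solution-1-3 t q ≤-refl (two-colours c₃ (c₂ ∘ sym))

arrows-4 : ∀ t q → 4 ≤ 3 * (1 + t * 2) + q → Arrows (suc (2 * (1 + t * 2) + q)) (3 * (1 + t * 2) + q) 4
arrows-4 t q 4≤a c with c 2 Bool.≟ c 1 | c 3 Bool.≟ c 2 | c 4 Bool.≟ c 2
... | yes c₂ | _      | _      = solution-1-2 (1 + t * 2) q (m≤m+n 2 2) c₂
... | no _   | yes c₃ | _      = solution-2-3 (1 + t * 2) q (n≤1+n 3) c₃
... | no _   | no _   | yes c₄ = solution-2-4 (1 + t * 2) q ≤-refl c₄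
... | no c₂  | no c₃  | no c₄  =
  solution-1-3-4 t q 4≤a ≤-refl (two-colours c₃ (c₂ ∘ sym)) (two-colours c₄ (c₂ ∘ sym))

n%2≢[1+n]%2 : ∀ n → n % 2 ≢ suc n % 2
n%2≢[1+n]%2 zero    ()
n%2≢[1+n]%2 (suc n) eq = n%2≢[1+n]%2 n (trans (sym ([2+n]%2≡n%2 n)) (sym eq))
  where
  [2+n]%2≡n%2 : ∀ n → suc (suc n) % 2 ≡ n % 2
  [2+n]%2≡n%2 n = trans (cong (_% 2) (+-comm 2 n)) ([m+n]%n≡m%n n 2)

vsum-odd : ∀ {k} {xs : Vec ℕ k} → All (λ x → x % 2 ≡ 1) xs → vsum xs % 2 ≡ k % 2
vsum-odd {xs = []}          []               = refl
vsum-odd {suc k} {x ∷ xs} (x-odd ∷ xs-odd) = begin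
  (x + vsum xs) % 2               ≡⟨ %-distribˡ-+ x (vsum xs) 2 ⟩
  (x % 2 + vsum xs % 2) % 2       ≡⟨ cong₂ (λ p r → (p + r) % 2) x-odd (vsum-odd xs-odd) ⟩
  (1 + k % 2) % 2                 ≡⟨ sym (%-distribˡ-+ 1 k 2) ⟩
  suc k % 2                       ∎
  where open ≡-Reasoning

*-odd-%2 : ∀ a {x} → x % 2 ≡ 1 → (a * x) % 2 ≡ a % 2
*-odd-%2 a {x} x-odd = begin
  (a * x) % 2           ≡⟨ %-distribˡ-* a x 2 ⟩
  (a % 2 * (x % 2)) % 2 ≡⟨ cong (λ r → (a % 2 * r) % 2) x-odd ⟩
  (a % 2 * 1) % 2       ≡⟨ cong (_% 2) (*-identityʳ (a % 2)) ⟩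
  a % 2 % 2             ≡⟨ m%n%n≡m%n a 2 ⟩
  a % 2                 ∎
  where open ≡-Reasoning

module _ {K a n : ℕ} {c : Coloring} {col : Bool} {xs : Vec ℕ K} {xm : ℕ}
         (xs-col : All (Coloured n c col) xs) (xm-col : Coloured n c col xm) where

  singleton-class-no-solution : ∀ v .{{_ : NonZero v}} → K < a →
    (∀ {x} → Coloured n c col x → x ≡ v) → vsum xs ≢ a * xm
  singleton-class-no-solution v K<a class eq with class xm-col
  ... | refl = <⇒≢ K<a (*-cancelʳ-≡ K a v (trans (sym (vsum-const (All.map class xs-col))) eq))

  odd-class-no-solution : K % 2 ≢ a % 2 →
    (∀ {x} → Coloured n c col x → x % 2 ≡ 1) → vsum xs ≢ a * xm
  odd-class-no-solution K≢a class eq =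
    K≢a (trans (sym (vsum-odd (All.map class xs-col))) (trans (cong (_% 2) eq) (*-odd-%2 a (class xm-col))))

parity-colouring : Coloring
parity-colouring x = x % 2 ≡ᵇ 1

parity-colouring-odd : ∀ {n x} → Coloured n parity-colouring true x → x % 2 ≡ 1
parity-colouring-odd {x = x} (_ , c-x) = ≡ᵇ⇒≡ (x % 2) 1 (subst T (sym c-x) tt)

parity-colouring-1 : ∀ {x} → Coloured 2 parity-colouring true x → x ≡ 1
parity-colouring-1 {1} _ = refl
parity-colouring-1 {0} ((() , _) , _)
parity-colouring-1 {2} (_ , ())
parity-colouring-1 {suc (suc (suc _))} ((_ , s≤s (s≤s ())) , _)

parity-colouring-2 : ∀ {x} → Coloured 3 parity-colouring false x → x ≡ 2
parity-colouring-2 {2} _ = refl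
parity-colouring-2 {0} ((() , _) , _)
parity-colouring-2 {1} (_ , ())
parity-colouring-2 {3} (_ , ())
parity-colouring-2 {suc (suc (suc (suc _)))} ((_ , s≤s (s≤s (s≤s ()))) , _)

¬arrows-2 : ∀ {K a} → K < a → ¬ Arrows (suc K) a 2
¬arrows-2 K<a arrows with arrows parity-colouring
... | true  , _ , _ , xs-col , xm∈ , c-xm , eq =
  singleton-class-no-solution xs-col (xm∈ , c-xm) 1 K<a parity-colouring-1 eq
... | false , _ , _ , xs-col , xm∈ , c-xm , eq =
  singleton-class-no-solution xs-col (xm∈ , c-xm) 2 K<a
    (parity-colouring-2 ∘ Coloured-mono {c = parity-colouring} (n≤1+n 2)) eq

¬arrows-3 : ∀ {K a} → K < a → K % 2 ≢ a % 2 → ¬ Arrows (suc K) a 3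
¬arrows-3 {a = a} K<a K≢a arrows with arrows parity-colouring
... | true  , _ , _ , xs-col , xm∈ , c-xm , eq =
  odd-class-no-solution {a = a} xs-col (xm∈ , c-xm) K≢a parity-colouring-odd eq
... | false , _ , _ , xs-col , xm∈ , c-xm , eq =
  singleton-class-no-solution xs-col (xm∈ , c-xm) 2 K<a parity-colouring-2 eq

decompose : ∀ K a → K < a → 2 * a ≤ 3 * K → ∃₂ λ s q → 0 < s × K ≡ 2 * s + q × a ≡ 3 * s + q
decompose K a K<a 2a≤3K with m≤n⇒∃[o]m+o≡n K<a
... | o , refl with m≤n⇒∃[o]m+o≡n 2s≤K
  where
  2s≤K : 2 * suc o ≤ K
  2s≤K = +-cancelʳ-≤ (2 * K) (2 * suc o) K (subst₂ _≤_ (lhs K o) (rhs K) 2a≤3K)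
    where
    lhs : ∀ K o → 2 * (suc K + o) ≡ 2 * suc o + 2 * K
    lhs = solve-∀
    rhs : ∀ K → 3 * K ≡ K + 2 * K
    rhs = solve-∀
...   | q , refl = suc o , q , s≤s z≤n , refl , a≡3s+q o q
  where
  a≡3s+q : ∀ o q → suc (2 * suc o + q) + o ≡ 3 * suc o + q
  a≡3s+q = solve-∀

2s+q<3s+q : ∀ s q → 0 < s → 2 * s + q < 3 * s + q
2s+q<3s+q s q 0<s = subst (2 * s + q <_) (sym (3s+q≡[2s+q]+s s q)) (m<m+n (2 * s + q) 0<s)
  where
  3s+q≡[2s+q]+s : ∀ s q → 3 * s + q ≡ 2 * s + q + s
  3s+q≡[2s+q]+s = solve-∀

rado-even : ∀ t q → Rado2Is (suc (2 * (suc t * 2) + q)) (3 * (suc t * 2) + q) 3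
rado-even t q = rado-from-threshold {a = 3 * (suc t * 2) + q} (arrows-3 (suc t) q)
  (¬arrows-2 (2s+q<3s+q (suc t * 2) q (s≤s z≤n)))

rado-odd : ∀ t q → 4 ≤ 3 * (1 + t * 2) + q → Rado2Is (suc (2 * (1 + t * 2) + q)) (3 * (1 + t * 2) + q) 4
rado-odd t q 4≤a = rado-from-threshold {a = 3 * (1 + t * 2) + q} (arrows-4 t q 4≤a)
  (¬arrows-3 (2s+q<3s+q (1 + t * 2) q (s≤s z≤n)) K≢a)
  where
  K = 2 * (1 + t * 2) + q
  a≡1+K+2t : ∀ t q → 3 * (1 + t * 2) + q ≡ suc (2 * (1 + t * 2) + q) + t * 2
  a≡1+K+2t = solve-∀
  K≢a : K % 2 ≢ (3 * (1 + t * 2) + q) % 2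
  K≢a eq = n%2≢[1+n]%2 K (trans eq (trans (cong (_% 2) (a≡1+K+2t t q)) ([m+kn]%n≡m%n (suc K) t 2)))

data EvenOdd : ℕ → Set where
  even : ∀ t → EvenOdd (t * 2)
  odd  : ∀ t → EvenOdd (1 + t * 2)

even-odd : ∀ n → EvenOdd n
even-odd zero    = even 0
even-odd (suc n) with even-odd n
... | even t = odd t
... | odd t  = even (suc t)

rado-by-parity : ∀ s q → 0 < s → 4 ≤ 3 * s + q →
  (s % 2 ≡ 0 → Rado2Is (suc (2 * s + q)) (3 * s + q) 3) ×
  (s % 2 ≢ 0 → Rado2Is (suc (2 * s + q)) (3 * s + q) 4)
rado-by-parity s q 0<s 4≤a with even-odd s
rado-by-parity .(zero * 2)  q ()  _   | even zero
rado-by-parity .(suc t * 2) q _   _   | even (suc t) =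
  (λ _ → rado-even t q) , (λ s≢0 → contradiction (m*n%n≡0 (suc t) 2) s≢0)
rado-by-parity .(1 + t * 2) q _   4≤a | odd t =
  (λ s≡0 → contradiction (trans (sym ([m+kn]%n≡m%n 1 t 2)) s≡0) 1+n≢0) , (λ _ → rado-odd t q 4≤a)

rado-a≥4 : ∀ a m → 2 * a + 3 ≤ 3 * m → m ≤ a → 4 ≤ a →
  ((a + m + 1) % 2 ≡ 0 → Rado2Is m a 3) × ((a + m + 1) % 2 ≢ 0 → Rado2Is m a 4)
rado-a≥4 a zero 2a+3≤0 _ _ = contradiction (≤-trans (m≤n+m 3 (2 * a)) 2a+3≤0) λ ()
rado-a≥4 a (suc K) 2a+3≤3m m≤a 4≤a with decompose K a m≤a 2a≤3K
  where
  3[1+K]≡3K+3 : ∀ K → 3 * suc K ≡ 3 * K + 3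
  3[1+K]≡3K+3 = solve-∀
  2a≤3K : 2 * a ≤ 3 * K
  2a≤3K = +-cancelʳ-≤ 3 (2 * a) (3 * K) (subst (2 * a + 3 ≤_) (3[1+K]≡3K+3 K) 2a+3≤3m)
... | s , q , 0<s , refl , refl with rado-by-parity s q 0<s 4≤a
...   | rado-3 , rado-4 = rado-3 ∘ trans (sym (parity s q)) , λ ≢0 → rado-4 (≢0 ∘ trans (parity s q))
  where
  a+m+1≡s+2[2s+q+1] : ∀ s q → 3 * s + q + suc (2 * s + q) + 1 ≡ s + (2 * s + q + 1) * 2
  a+m+1≡s+2[2s+q+1] = solve-∀
  parity : ∀ s q → (3 * s + q + suc (2 * s + q) + 1) % 2 ≡ s % 2
  parity s q = trans (cong (_% 2) (a+m+1≡s+2[2s+q+1] s q)) ([m+kn]%n≡m%n s (2 * s + q + 1) 2)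

mono-triple : ∀ {a n c} x y z → InRange n x → InRange n y → InRange n z →
  c x ≡ c z → c y ≡ c z → x + y ≡ a * z → MonoSol 3 a n c
mono-triple {c = c} x y z x∈ y∈ z∈ cx cy eq =
  c z , x ∷ y ∷ [] , z , (x∈ , cx) ∷ (y∈ , cy) ∷ [] , z∈ , refl , trans (cong (x +_) (+-identityʳ y)) eq

arrows-3-3-9 : Arrows 3 3 9
arrows-3-3-9 c with c 3 Bool.≟ c 2
... | yes c₃ =
      mono-triple {a = 3} 3 3 2 (in-range 3 ≤-refl) (in-range 3 ≤-refl) (in-range 2 ≤-refl) c₃ c₃ refl
... | no c₃ with c 9 Bool.≟ c 3
...   | no c₉ with c 6 Bool.≟ c 3
...     | yes c₆ =
      mono-triple {a = 3} 3 6 3 (in-range 3 ≤-refl) (in-range 6 ≤-refl) (in-range 3 ≤-refl) refl c₆ refl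
...     | no c₆  =
      mono-triple {a = 3} 9 9 6 (in-range 9 ≤-refl) (in-range 9 ≤-refl) (in-range 6 ≤-refl) c₉₆ c₉₆ refl
  where c₉₆ = two-colours c₉ c₆
arrows-3-3-9 c | no c₃ | yes c₉ with c 4 Bool.≟ c 2
...     | yes c₄ =
      mono-triple {a = 3} 2 4 2 (in-range 2 ≤-refl) (in-range 4 ≤-refl) (in-range 2 ≤-refl) refl c₄ refl
...     | no c₄  =
      mono-triple {a = 3} 3 9 4 (in-range 3 ≤-refl) (in-range 9 ≤-refl) (in-range 4 ≤-refl) c₃₄ (trans c₉ c₃₄) refl
  where c₃₄ = two-colours c₃ c₄

TripleFree : Coloring → ℕ → ℕ → ℕ → ℕ → Set
TripleFree c a x y z = c x ≡ c z → c y ≡ c z → x + y ≢ a * z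

triple-free? : ∀ c a x y z → Dec (TripleFree c a x y z)
triple-free? c a x y z = (c x Bool.≟ c z) →-dec (c y Bool.≟ c z) →-dec ¬? (x + y ≟ a * z)

¬mono-triple : ∀ {a n c} →
  (∀ {x} → x < n → ∀ {y} → y < n → ∀ {z} → z < n → TripleFree c a (suc x) (suc y) (suc z)) →
  ¬ MonoSol 3 a n c
¬mono-triple free (_ , suc x ∷ suc y ∷ [] , suc z , ((_ , x<n) , cx) ∷ ((_ , y<n) , cy) ∷ [] , (_ , z<n) , cz , eq) =
  free x<n y<n z<n (trans cx (sym cz)) (trans cy (sym cz)) (trans (cong (suc x +_) (sym (+-identityʳ (suc y)))) eq)
¬mono-triple _ (_ , zero ∷ _ ∷ [] , _ , ((() , _) , _) ∷ _ , _)
¬mono-triple _ (_ , suc _ ∷ zero ∷ [] , _ , _ ∷ ((() , _) , _) ∷ [] , _)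
¬mono-triple _ (_ , suc _ ∷ suc _ ∷ [] , zero , _ , (() , _) , _)

colouring-8 : Coloring
colouring-8 2 = true
colouring-8 5 = true
colouring-8 6 = true
colouring-8 8 = true
colouring-8 _ = false

¬arrows-3-3-8 : ¬ Arrows 3 3 8
¬arrows-3-3-8 arrows = ¬mono-triple {a = 3} triple-free (arrows colouring-8)
  where
  triple-free : ∀ {x} → x < 8 → ∀ {y} → y < 8 → ∀ {z} → z < 8 →
    TripleFree colouring-8 3 (suc x) (suc y) (suc z)
  triple-free = from-yes (allUpTo? (λ x → allUpTo? (λ y → allUpTo? (λ z →
    triple-free? colouring-8 3 (suc x) (suc y) (suc z)) 8) 8) 8)

rado-3-3 : Rado2Is 3 3 9
rado-3-3 = rado-from-threshold {a = 3} arrows-3-3-9 ¬arrows-3-3-8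

theorem4 : (a m : ℕ) → 3 ≤ a → 2 * a + 3 ≤ 3 * m → m ≤ a →
    (a ≡ 3 → Rado2Is a a 9) ×
    (4 ≤ a → (a + m + 1) % 2 ≡ 0 → Rado2Is m a 3) ×
    (4 ≤ a → (a + m + 1) % 2 ≢ 0 → Rado2Is m a 4)
theorem4 a m _ 2a+3≤3m m≤a =
  (λ { refl → rado-3-3 }) ,
  (λ 4≤a → proj₁ (rado-a≥4 a m 2a+3≤3m m≤a 4≤a)) ,
  (λ 4≤a → proj₂ (rado-a≥4 a m 2a+3≤3m m≤a 4≤a))
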